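{- Let $\sigma$ be the bijection of $1+X\overline{\mathbb F_2}[[X]]$ defined below, and for $A\in 1+X\overline{\mathbb F_2}[[X]]$ let its orbit be $\{\sigma^k(A):k\in\mathbb Z\}$. Write $A=\sum_{n\ge0}\alpha_nX^n$. Then: (i) if $\alpha_{2^k}\neq 0$ for some integer $k\ge0$, the orbit of $A$ is infinite; (ii) if $A\in 1+X\overline{\mathbb F_2}[X]$ is a polynomial with $\alpha_{2^k}=0$ for all $k\ge 0$, the orbit of $A$ is finite; (iii) every finite orbit of $\sigma$ in $1+X\overline{\mathbb F_2}[[X]]$ has cardinality a power of $2$.
   Context: For $A=\sum_{n\ge0}\alpha_nX^n\in\overline{\mathbb F_2}[[X]]$, $\sigma(A)=\alpha_0^2+\sum_{n\ge0}\alpha_{2^n}^2X^{2^{n+1}}+\sum_{0\le i<j}\binom{i+j}{i}\alpha_i\alpha_jX^{i+j}$ (binomial coefficients reduced mod 2). The map $\sigma$ restricts to a bijection of $1+X\overline{\mathbb F_2}[[X]]$, so $\sigma^k$ is defined for all $k\in\mathbb Z$ there. -}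

module Defs where

open import Level using (Level; _⊔_) renaming (suc to lsuc)
open import Algebra.Bundles using (CommutativeRing)
open import Data.Nat as ℕ using (ℕ; zero; suc; _≤_; _<ᵇ_; _≡ᵇ_; _∸_)
open import Data.Nat.Combinatorics using (_C_)
open import Data.Nat.Properties using ()
open import Data.Bool using (Bool; true; false; if_then_else_; _∧_; _∨_)
open import Data.List using (List; []; _∷_; length; upTo)
open import Data.Bool.ListAction using (any)
open import Data.Fin using (Fin)
open import Data.Product using (Σ; ∃; _×_; _,_)
open import Data.Sum using (_⊎_)
open import Relation.Nullary using (¬_; Dec)
open import Relation.Binary.PropositionalEquality using (_≡_)

-- An algebraic closure of 𝔽₂, axiomatised up to isomorphism:
-- a field of characteristic 2, algebraically closed, in which every
-- element is algebraic over 𝔽₂ (equivalently lies in some 𝔽_{2^n},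
-- i.e. satisfies x^(2^n) = x for some n ≥ 1).  These properties
-- characterise \overline{𝔽₂} up to isomorphism.  Equality in 𝔽̄₂ is
-- decidable, which is recorded as well (a true property of 𝔽̄₂).

module RingPoly {c ℓ} (R : CommutativeRing c ℓ) where
  open CommutativeRing R

  pow : Carrier → ℕ → Carrier
  pow x zero    = 1#
  pow x (suc n) = x * pow x n

  -- evaluation of the monic polynomial X^d + c_{d-1}X^{d-1} + ... + c_0,
  -- where the list is [c_0, ..., c_{d-1}] and d = its length
  evalMonic : List Carrier → Carrier → Carrier
  evalMonic []       x = 1#
  evalMonic (c ∷ cs) x = c + x * evalMonic cs x

record AlgClosureF2 (c ℓ : Level) : Set (lsuc (c ⊔ ℓ)) where
  field
    cring : CommutativeRing c ℓ
  open CommutativeRing cring public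
  open RingPoly cring public

  field
    _≟_         : (x y : Carrier) → Dec (x ≈ y)
    nontrivial  : ¬ (1# ≈ 0#)
    inverse     : ∀ x → ¬ (x ≈ 0#) → Σ Carrier λ y → x * y ≈ 1#
    char2       : 1# + 1# ≈ 0#
    algClosed   : (cs : List Carrier) → 1 ≤ length cs →
                  Σ Carrier λ x → evalMonic cs x ≈ 0#
    algebraicF2 : ∀ x → Σ ℕ λ n → 1 ≤ n × pow x (ℕ._^_ 2 n) ≈ x

module PowerSeries {c ℓ} (K : AlgClosureF2 c ℓ) where
  open AlgClosureF2 K

  PS : Set c
  PS = ℕ → Carrier

  _≈ₛ_ : PS → PS → Set ℓ
  A ≈ₛ B = ∀ n → A n ≈ B n

  OneUnit : PS → Set ℓ
  OneUnit A = A 0 ≈ 1#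

  Polynomial : PS → Set ℓ
  Polynomial A = Σ ℕ λ N → ∀ n → N ≤ n → A n ≈ 0#

  -- is m of the form 2^(n+1) for some n ≥ 0 (any such n satisfies n < m)
  isPow2Pos : ℕ → Bool
  isPow2Pos m = any (λ n → ℕ._^_ 2 (suc n) ≡ᵇ m) (upTo m)

  odd : ℕ → Bool
  odd zero          = false
  odd (suc zero)    = true
  odd (suc (suc n)) = odd n

  sumTo : ℕ → (ℕ → Carrier) → Carrier
  sumTo zero    f = 0#
  sumTo (suc k) f = sumTo k f + f k

  -- coefficient of X^m in σ(A):
  --   [m = 0] α₀² + [m = 2^(n+1)] α_{2^n}²   (both = α_{m/2}²) + Σ_{i<j, i+j=m} binom(m,i) α_i α_j
  σ : PS → PS
  σ A m = diag + cross
    where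
    diag : Carrier
    diag = if (m ≡ᵇ 0) ∨ isPow2Pos m then A (ℕ._/_ m 2) * A (ℕ._/_ m 2) else 0#
    cross : Carrier
    cross = sumTo (suc m) λ i →
      if (i <ᵇ (m ∸ i)) ∧ odd (m C i) then A i * A (m ∸ i) else 0#

  σ^ : ℕ → PS → PS
  σ^ zero    A = A
  σ^ (suc k) A = σ (σ^ k A)

  -- Since σ is a bijection of 1 + X𝔽̄₂[[X]], B = σ^k(A) with k ∈ ℤ iff
  -- B ∈ 1 + X𝔽̄₂[[X]] and (σ^k(A) = B or σ^k(B) = A for some k ≥ 0).
  InOrbit : PS → PS → Set ℓ
  InOrbit A B = OneUnit B × Σ ℕ λ k → (σ^ k A ≈ₛ B) ⊎ (σ^ k B ≈ₛ A)

  OrbitCard : PS → ℕ → Set (c ⊔ ℓ)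
  OrbitCard A m =
    Σ (Fin m → PS) λ f →
      (∀ i → InOrbit A (f i)) ×
      (∀ B → InOrbit A B → Σ (Fin m) λ i → f i ≈ₛ B) ×
      (∀ i j → f i ≈ₛ f j → i ≡ j)

  FiniteOrbit : PS → Set (c ⊔ ℓ)
  FiniteOrbit A = Σ ℕ λ m → OrbitCard A m

-- In characteristic 2 the increment σ(B)_N + B_N depends only on the coefficients of B below N.
-- Iterating, σ^(2^N) fixes every unit series modulo X^N. So modulo X^N a period p of A and the
-- period 2^(v+N) coexist, where 2^v is the 2-adic part of p, and hence 2^v is a period too:
-- a finite orbit has a period 2^v, its least period is a power of 2, and that is its size.
-- On the coefficients a_j = A(2^j), σ acts by a_{j+1} ↦ a_{j+1} + a_j², hence σ^(2^v) by
-- a_{j+2^v} ↦ a_{j+2^v} + a_j^(2^(2^v)); a period 2^v therefore forces every a_j to vanish.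
-- Conversely, the unit polynomials of degree < 2^N without monomials X^(2^k) are stable under σ,
-- since binom(i+j, i) is even when adding i, j < 2^N carries past 2^N; σ^(2^(2^N)) fixes them.
module Submission where

open import Defs
open import Level using (Level; _⊔_)
open import Data.Nat using (ℕ; _^_)
open import Data.Product using (Σ; _×_; _,_; proj₂)
open import Relation.Nullary using (¬_)
open import Relation.Binary.PropositionalEquality using (_≡_)

module Naturals where

  open import Data.Nat
  open import Data.Nat.Properties
  open import Data.Nat.DivMod using (m*n/n≡m)
  open import Data.Nat.Combinatorics using (_C_; nCk+nC[k+1]≡[n+1]C[k+1])
  open import Data.Nat.Induction using (<-rec)
  open import Data.Nat.Tactic.RingSolver using (solve-∀)
  import Data.Parity.Base as ℙ
  open import Data.Parity.Base using (0ℙ)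
  open import Data.Parity.Properties using (+-homo-+; p+p≡0ℙ) renaming (+-identityʳ to ℙ-+-identityʳ)
  open import Data.Product using (∃; ∃₂)
  open import Relation.Nullary using (yes; no; contradiction)
  open import Relation.Unary using (Decidable)
  open import Relation.Binary.PropositionalEquality
  open ≡-Reasoning

  double : ℕ → ℕ
  double zero    = zero
  double (suc n) = suc (suc (double n))

  double≡n+n : ∀ n → double n ≡ n + n
  double≡n+n zero    = refl
  double≡n+n (suc n) = cong suc (trans (cong suc (double≡n+n n)) (sym (+-suc n n)))

  double-distrib-+ : ∀ m n → double m + double n ≡ double (m + n)
  double-distrib-+ zero    n = refl
  double-distrib-+ (suc m) n = cong (λ k → suc (suc k)) (double-distrib-+ m n)

  n≤double : ∀ n → n ≤ double n
  n≤double zero    = z≤n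
  n≤double (suc n) = s≤s (m≤n⇒m≤1+n (n≤double n))

  double-cancel-≤ : ∀ {m n} → double m ≤ suc (double n) → m ≤ n
  double-cancel-≤ {zero}              _              = z≤n
  double-cancel-≤ {suc m} {zero}      (s≤s ())
  double-cancel-≤ {suc m} {suc n}     (s≤s (s≤s le)) = s≤s (double-cancel-≤ le)

  2^[1+n]≡2^n+2^n : ∀ n → 2 ^ suc n ≡ 2 ^ n + 2 ^ n
  2^[1+n]≡2^n+2^n n = cong (2 ^ n +_) (+-identityʳ (2 ^ n))

  n<2^n : ∀ n → n < 2 ^ n
  n<2^n zero    = z<s
  n<2^n (suc n) = subst (suc n <_) (sym (2^[1+n]≡2^n+2^n n)) (+-mono-≤ (m^n>0 2 n) (n<2^n n))

  2^[1+n]/2≡2^n : ∀ n → 2 ^ suc n / 2 ≡ 2 ^ n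
  2^[1+n]/2≡2^n n = trans (cong (_/ 2) (*-comm 2 (2 ^ n))) (m*n/n≡m (2 ^ n) 2)

  data Halving : ℕ → Set where
    2·_   : ∀ a → Halving (double a)
    1+2·_ : ∀ a → Halving (suc (double a))

  halving : ∀ n → Halving n
  halving zero = 2· zero
  halving (suc n) with halving n
  ... | 2· a   = 1+2· a
  ... | 1+2· a = 2· suc a

  parity-pascal : ∀ n k → parity (suc n C suc k) ≡ parity (n C k) ℙ.+ parity (n C suc k)
  parity-pascal n k =
    trans (cong parity (sym (nCk+nC[k+1]≡[n+1]C[k+1] n k))) (+-homo-+ (n C k) (n C suc k))

  parity[2aC2c]≡parity[aCc]       : ∀ a c → parity (double a C double c) ≡ parity (a C c)
  parity[2aC1+2c]≡0               : ∀ a c → parity (double a C suc (double c)) ≡ 0ℙ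
  parity[1+2aC2c]≡parity[aCc]     : ∀ a c → parity (suc (double a) C double c) ≡ parity (a C c)
  parity[1+2aC1+2c]≡parity[aCc]   : ∀ a c → parity (suc (double a) C suc (double c)) ≡ parity (a C c)

  parity[2aC2c]≡parity[aCc] zero    zero    = refl
  parity[2aC2c]≡parity[aCc] zero    (suc c) = refl
  parity[2aC2c]≡parity[aCc] (suc a) zero    = refl
  parity[2aC2c]≡parity[aCc] (suc a) (suc c) = begin
    parity (double (suc a) C double (suc c))
      ≡⟨ parity-pascal (suc (double a)) (suc (double c)) ⟩
    parity (suc (double a) C suc (double c)) ℙ.+ parity (suc (double a) C double (suc c))
      ≡⟨ cong₂ ℙ._+_ (parity[1+2aC1+2c]≡parity[aCc] a c) (parity[1+2aC2c]≡parity[aCc] a (suc c)) ⟩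
    parity (a C c) ℙ.+ parity (a C suc c)
      ≡⟨ parity-pascal a c ⟨
    parity (suc a C suc c) ∎

  parity[2aC1+2c]≡0 zero    c = refl
  parity[2aC1+2c]≡0 (suc a) c = begin
    parity (double (suc a) C suc (double c))
      ≡⟨ parity-pascal (suc (double a)) (double c) ⟩
    parity (suc (double a) C double c) ℙ.+ parity (suc (double a) C suc (double c))
      ≡⟨ cong₂ ℙ._+_ (parity[1+2aC2c]≡parity[aCc] a c) (parity[1+2aC1+2c]≡parity[aCc] a c) ⟩
    parity (a C c) ℙ.+ parity (a C c)
      ≡⟨ p+p≡0ℙ (parity (a C c)) ⟩
    0ℙ ∎

  parity[1+2aC2c]≡parity[aCc] a zero    = refl
  parity[1+2aC2c]≡parity[aCc] a (suc c) =
    trans (parity-pascal (double a) (suc (double c)))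
          (cong₂ ℙ._+_ (parity[2aC1+2c]≡0 a c) (parity[2aC2c]≡parity[aCc] a (suc c)))

  parity[1+2aC1+2c]≡parity[aCc] a c =
    trans (parity-pascal (double a) (double c))
          (trans (cong₂ ℙ._+_ (parity[2aC2c]≡parity[aCc] a c) (parity[2aC1+2c]≡0 a c))
                 (ℙ-+-identityʳ (parity (a C c))))

  -- Kummer: adding i and j in base 2 carries out of the L low digits.
  parity[[i+j]Ci]≡0 : ∀ L {i j} → i < 2 ^ L → j < 2 ^ L → 2 ^ L ≤ i + j →
                      parity ((i + j) C i) ≡ 0ℙ
  parity[[i+j]Ci]≡0 zero    {zero}  {zero}  _ _ ()
  parity[[i+j]Ci]≡0 zero    {zero}  {suc _} _ (s≤s ()) _
  parity[[i+j]Ci]≡0 zero    {suc _}         (s≤s ()) _ _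
  parity[[i+j]Ci]≡0 (suc L) {i} {j} i< j< ≤i+j
    rewrite 2^[1+n]≡2^n+2^n L | sym (double≡n+n (2 ^ L)) = go (halving i) (halving j) i< j< ≤i+j
    where
    Q = 2 ^ L
    go : ∀ {i j} → Halving i → Halving j → i < double Q → j < double Q → double Q ≤ i + j →
         parity ((i + j) C i) ≡ 0ℙ
    go (2· a) (2· b) i< j< ≤i+j rewrite double-distrib-+ a b =
      trans (parity[2aC2c]≡parity[aCc] (a + b) a)
            (parity[[i+j]Ci]≡0 L (double-cancel-≤ (s≤s i<)) (double-cancel-≤ (s≤s j<))
                                 (double-cancel-≤ (m≤n⇒m≤1+n ≤i+j)))
    go (1+2· a) (2· b) i< j< ≤i+j rewrite double-distrib-+ a b =
      trans (parity[1+2aC1+2c]≡parity[aCc] (a + b) a)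
            (parity[[i+j]Ci]≡0 L (double-cancel-≤ (m≤n⇒m≤1+n i<)) (double-cancel-≤ (s≤s j<))
                                 (double-cancel-≤ ≤i+j))
    go (2· a) (1+2· b) i< j< ≤i+j rewrite +-suc (double a) (double b) | double-distrib-+ a b =
      trans (parity[1+2aC2c]≡parity[aCc] (a + b) a)
            (parity[[i+j]Ci]≡0 L (double-cancel-≤ (s≤s i<)) (double-cancel-≤ (m≤n⇒m≤1+n j<))
                                 (double-cancel-≤ ≤i+j))
    go (1+2· a) (1+2· b) _ _ _ rewrite +-suc (double a) (double b) | double-distrib-+ a b =
      parity[2aC1+2c]≡0 (suc (a + b)) a

  2-adic : ∀ t → 0 < t → ∃₂ λ u s → t ≡ 2 ^ u * suc (double s)
  2-adic = <-rec (λ t → 0 < t → ∃₂ λ u s → t ≡ 2 ^ u * suc (double s)) step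
    where
    step : ∀ t → (∀ {t′} → t′ < t → 0 < t′ → ∃₂ λ u s → t′ ≡ 2 ^ u * suc (double s)) →
           0 < t → ∃₂ λ u s → t ≡ 2 ^ u * suc (double s)
    step t rec 0<t with halving t
    ... | 1+2· s     = 0 , s , sym (+-identityʳ _)
    ... | 2· zero    = contradiction 0<t (n≮n 0)
    ... | 2· (suc a) with rec (s≤s (s≤s (n≤double a))) z<s
    ...   | u , s , a≡ = suc u , s , (begin
      double (suc a)                          ≡⟨ double≡n+n (suc a) ⟩
      suc a + suc a                           ≡⟨ cong (λ x → x + x) a≡ ⟩
      2 ^ u * o + 2 ^ u * o                   ≡⟨ twice (2 ^ u) o ⟩
      2 ^ suc u * o ∎)
      where
      o = suc (double s)
      twice : ∀ x y → x * y + x * y ≡ (2 * x) * y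
      twice = solve-∀

  record IsDifferenceClosed {q} (Q : ℕ → Set q) : Set q where
    field
      0-closed : Q 0
      +-closed : ∀ {a b} → Q a → Q b → Q (a + b)
      ∸-closed : ∀ {a b} → Q (a + b) → Q a → Q b

    *-closed : ∀ n {a} → Q a → Q (n * a)
    *-closed zero    _  = 0-closed
    *-closed (suc n) qa = +-closed qa (*-closed n qa)

    2-adic-part-closed : ∀ u s d → Q (2 ^ u * suc (double s)) → Q (2 ^ (u + d)) → Q (2 ^ u)
    2-adic-part-closed u s zero    _  q = subst Q (cong (2 ^_) (+-identityʳ u)) q
    2-adic-part-closed u s (suc d) qt q =
      2-adic-part-closed u s d qt (∸-closed (subst Q split (*-closed (2 ^ d) qt)) (*-closed s q))
      where
      split : 2 ^ d * (2 ^ u * suc (double s)) ≡ s * 2 ^ (u + suc d) + 2 ^ (u + d)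
      split rewrite double≡n+n s | ^-distribˡ-+-* 2 u (suc d) | ^-distribˡ-+-* 2 u d =
        identity (2 ^ d) (2 ^ u) s
        where
        identity : ∀ x y s → x * (y * suc (s + s)) ≡ s * (y * (2 * x)) + y * x
        identity = solve-∀

  least-witness : ∀ {q} {Q : ℕ → Set q} → Decidable Q → ∀ {v} → Q v →
                  ∃ λ w → Q w × (∀ {u} → u < w → ¬ Q u)
  least-witness {Q = Q} Q? {v} = <-rec (λ v → Q v → Least) step v
    where
    Least = ∃ λ w → Q w × (∀ {u} → u < w → ¬ Q u)
    step : ∀ v → (∀ {u} → u < v → Q u → Least) → Q v → Least
    step v rec qv with anyUpTo? Q? v
    ... | yes (u , u<v , qu) = rec u<v qu
    ... | no none            = v , qv , λ u<v qu → none (_ , u<v , qu)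

module _ {c ℓ : Level} (K : AlgClosureF2 c ℓ) where

  open AlgClosureF2 K
  open PowerSeries K
  open Naturals

  open import Data.Nat
    using (zero; suc; _<_; _≤_; _∸_; _<ᵇ_; _≡ᵇ_; z≤n; s≤s; z<s; NonZero; parity; _≤?_; _<?_)
    renaming (_+_ to _+ℕ_; _*_ to _*ℕ_)
  open import Data.Nat.Properties as ℕₚ
    using (≤-refl; <⇒≤; <-≤-trans; ≤-<-trans; m∸n≤m; ∸-monoʳ-<; m+[n∸m]≡n; n∸n≡0; m^n>0; m^n≢0;
           m<1+n⇒m<n∨m≡n; ≰⇒>; ≮⇒≥; <⇒≱; n≮0; m≤m*n; ^-monoʳ-≤; ^-distribˡ-+-*; m<n⇒0<n∸m;
           <ᵇ⇒<; ≡ᵇ⇒≡; ≡⇒≡ᵇ; n<1+n; <-cmp; allUpTo?)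
  open import Data.Nat.DivMod using (_/_; _%_; m%n<n; m≡m%n+[m/n]*n; m/n≤m; m/n<m)
  open import Data.Nat.Combinatorics using (_C_)
  open import Data.Parity.Base using (0ℙ)
  open import Data.Bool using (true; false; T; if_then_else_; _∧_; _∨_)
  open import Data.Bool.Properties using (T-∧; T-∨)
  open import Data.Empty using (⊥-elim)
  open import Data.Fin using (Fin; toℕ; fromℕ<)
  import Data.Fin.Properties as Fin
  open import Data.List using (upTo)
  open import Data.List.Membership.Propositional using (lose)
  open import Data.List.Membership.Propositional.Properties using (∈-upTo⁺)
  open import Data.List.Relation.Unary.Any using (satisfied)
  open import Data.List.Relation.Unary.Any.Properties using (any⁺; any⁻)
  open import Data.Product using (∃; proj₁; proj₂)
  open import Data.Sum using (inj₁; inj₂)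
  open import Function using (_∘_)
  open import Function.Bundles using (Equivalence)
  open import Relation.Nullary using (yes; no; contradiction)
  open import Relation.Unary using (Decidable)
  open import Relation.Binary using (Setoid; tri<; tri≈; tri>)
  import Relation.Binary.PropositionalEquality as ≡
  open import Relation.Binary.Reasoning.Setoid setoid
  open import Algebra.Properties.CommutativeSemigroup +-commutativeSemigroup using (interchange)
  open import Algebra.Properties.CommutativeSemigroup *-commutativeSemigroup
    using () renaming (interchange to *-interchange)
  open import Algebra.Properties.Group +-group using (∙-cancelˡ; ∙-cancelʳ)

  x+x≈0 : ∀ x → x + x ≈ 0#
  x+x≈0 x = begin
    x + x            ≈⟨ +-cong (*-identityʳ x) (*-identityʳ x) ⟨
    x * 1# + x * 1#  ≈⟨ distribˡ x 1# 1# ⟨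
    x * (1# + 1#)    ≈⟨ *-congˡ char2 ⟩
    x * 0#           ≈⟨ zeroʳ x ⟩
    0# ∎

  x+y≈0⇒x≈y : ∀ {x y} → x + y ≈ 0# → x ≈ y
  x+y≈0⇒x≈y {x} {y} x+y≈0 = ∙-cancelʳ y x y (trans x+y≈0 (sym (x+x≈0 y)))

  x≈y⇒x+y≈0 : ∀ {x y} → x ≈ y → x + y ≈ 0#
  x≈y⇒x+y≈0 {y = y} x≈y = trans (+-congʳ x≈y) (x+x≈0 y)

  +-exchange : ∀ {a b c d} → a + b ≈ c + d → a + c ≈ b + d
  +-exchange {a} {b} {c} {d} a+b≈c+d = x+y≈0⇒x≈y (begin
    (a + c) + (b + d)  ≈⟨ interchange a c b d ⟩
    (a + b) + (c + d)  ≈⟨ +-congʳ a+b≈c+d ⟩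
    (c + d) + (c + d)  ≈⟨ x+x≈0 (c + d) ⟩
    0# ∎)

  +-telescope : ∀ a b c → (a + b) + (b + c) ≈ a + c
  +-telescope a b c = begin
    (a + b) + (b + c)  ≈⟨ +-assoc a b (b + c) ⟩
    a + (b + (b + c))  ≈⟨ +-congˡ (+-assoc b b c) ⟨
    a + ((b + b) + c)  ≈⟨ +-congˡ (+-congʳ (x+x≈0 b)) ⟩
    a + (0# + c)       ≈⟨ +-congˡ (+-identityˡ c) ⟩
    a + c ∎

  square-+ : ∀ a b → (a + b) * (a + b) ≈ a * a + b * b
  square-+ a b = begin
    (a + b) * (a + b)                  ≈⟨ distribʳ (a + b) a b ⟩
    a * (a + b) + b * (a + b)          ≈⟨ +-cong (distribˡ a a b) (distribˡ b a b) ⟩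
    (a * a + a * b) + (b * a + b * b)  ≈⟨ +-congˡ (+-comm (b * a) (b * b)) ⟩
    (a * a + a * b) + (b * b + b * a)  ≈⟨ interchange (a * a) (a * b) (b * b) (b * a) ⟩
    (a * a + b * b) + (a * b + b * a)  ≈⟨ +-congˡ (x≈y⇒x+y≈0 (*-comm a b)) ⟩
    (a * a + b * b) + 0#               ≈⟨ +-identityʳ (a * a + b * b) ⟩
    a * a + b * b ∎

  square≈0⇒≈0 : ∀ {x} → x * x ≈ 0# → x ≈ 0#
  square≈0⇒≈0 {x} x²≈0 with x ≟ 0#
  ... | yes x≈0 = x≈0
  ... | no x≉0 with inverse x x≉0
  ...   | y , xy≈1 = contradiction (begin
      1#                 ≈⟨ *-identityˡ 1# ⟨
      1# * 1#            ≈⟨ *-cong xy≈1 xy≈1 ⟨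
      (x * y) * (x * y)  ≈⟨ *-interchange x y x y ⟩
      (x * x) * (y * y)  ≈⟨ *-congʳ x²≈0 ⟩
      0# * (y * y)       ≈⟨ zeroˡ (y * y) ⟩
      0# ∎) nontrivial

  frob : ℕ → Carrier → Carrier
  frob zero    x = x
  frob (suc n) x = frob n x * frob n x

  frob-cong : ∀ n {x y} → x ≈ y → frob n x ≈ frob n y
  frob-cong zero    x≈y = x≈y
  frob-cong (suc n) x≈y = *-cong (frob-cong n x≈y) (frob-cong n x≈y)

  frob-+ : ∀ n x y → frob n (x + y) ≈ frob n x + frob n y
  frob-+ zero    x y = refl
  frob-+ (suc n) x y = trans (*-cong (frob-+ n x y) (frob-+ n x y)) (square-+ (frob n x) (frob n y))

  frob-+ℕ : ∀ m n x → frob (m +ℕ n) x ≡ frob m (frob n x)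
  frob-+ℕ zero    n x = ≡.refl
  frob-+ℕ (suc m) n x = ≡.cong (λ y → y * y) (frob-+ℕ m n x)

  frob≈0⇒≈0 : ∀ n {x} → frob n x ≈ 0# → x ≈ 0#
  frob≈0⇒≈0 zero    x≈0 = x≈0
  frob≈0⇒≈0 (suc n) fx≈0 = frob≈0⇒≈0 n (square≈0⇒≈0 fx≈0)

  if-cong : ∀ b {x y} → (T b → x ≈ y) → (if b then x else 0#) ≈ (if b then y else 0#)
  if-cong true  x≈y = x≈y _
  if-cong false _   = refl

  if-true : ∀ {b} x → T b → (if b then x else 0#) ≈ x
  if-true {true} x _ = refl

  if-≈0 : ∀ b {x} → (T b → x ≈ 0#) → (if b then x else 0#) ≈ 0#
  if-≈0 true  x≈0 = x≈0 _
  if-≈0 false _   = refl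

  sumTo-cong : ∀ k {f g : ℕ → Carrier} → (∀ {i} → i < k → f i ≈ g i) → sumTo k f ≈ sumTo k g
  sumTo-cong zero    _   = refl
  sumTo-cong (suc k) f≈g = +-cong (sumTo-cong k (f≈g ∘ ℕₚ.m<n⇒m<1+n)) (f≈g ≤-refl)

  sumTo-≈0 : ∀ k {f : ℕ → Carrier} → (∀ {i} → i < k → f i ≈ 0#) → sumTo k f ≈ 0#
  sumTo-≈0 zero    _   = refl
  sumTo-≈0 (suc k) f≈0 = trans (+-cong (sumTo-≈0 k (f≈0 ∘ ℕₚ.m<n⇒m<1+n)) (f≈0 ≤-refl)) (+-identityˡ 0#)

  sumTo-+ : ∀ k (f g : ℕ → Carrier) → sumTo k f + sumTo k g ≈ sumTo k (λ i → f i + g i)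
  sumTo-+ zero    f g = +-identityˡ 0#
  sumTo-+ (suc k) f g = trans (interchange _ _ _ _) (+-congʳ (sumTo-+ k f g))

  sumTo-head : ∀ k {f : ℕ → Carrier} → (∀ {i} → 0 < i → i < suc k → f i ≈ 0#) → sumTo (suc k) f ≈ f 0
  sumTo-head zero    _   = +-identityˡ _
  sumTo-head (suc k) f≈0 =
    trans (+-cong (sumTo-head k (λ 0<i → f≈0 0<i ∘ ℕₚ.m<n⇒m<1+n)) (f≈0 z<s ≤-refl)) (+-identityʳ _)

  ≈ₛ-setoid : Setoid c ℓ
  ≈ₛ-setoid = record
    { Carrier       = PS
    ; _≈_           = _≈ₛ_
    ; isEquivalence = record
      { refl  = λ _ → refl
      ; sym   = λ A≈B n → sym (A≈B n)
      ; trans = λ A≈B B≈C n → trans (A≈B n) (B≈C n)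
      }
    }

  module ≈ₛ = Setoid ≈ₛ-setoid

  _≈[<_]_ : PS → ℕ → PS → Set ℓ
  A ≈[< N ] B = ∀ {m} → m < N → A m ≈ B m

  ≈[<]-reflexive : ∀ {N A B} → A ≡ B → A ≈[< N ] B
  ≈[<]-reflexive ≡.refl _ = refl

  ≈[<]-sym : ∀ {N A B} → A ≈[< N ] B → B ≈[< N ] A
  ≈[<]-sym A≈B m<N = sym (A≈B m<N)

  ≈[<]-trans : ∀ {N A B C} → A ≈[< N ] B → B ≈[< N ] C → A ≈[< N ] C
  ≈[<]-trans A≈B B≈C m<N = trans (A≈B m<N) (B≈C m<N)

  ≈[<]-extend : ∀ {N A B} → A ≈[< N ] B → A N ≈ B N → A ≈[< suc N ] B
  ≈[<]-extend A≈B AN≈BN m<1+N with m<1+n⇒m<n∨m≡n m<1+N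
  ... | inj₁ m<N  = A≈B m<N
  ... | inj₂ ≡.refl = AN≈BN

  ≈ₛ⇒≈[<] : ∀ {A B} → A ≈ₛ B → ∀ N → A ≈[< N ] B
  ≈ₛ⇒≈[<] A≈B N {m} _ = A≈B m

  ≈[<]⇒≈ₛ : ∀ {A B} → (∀ N → A ≈[< N ] B) → A ≈ₛ B
  ≈[<]⇒≈ₛ A≈B m = A≈B (suc m) ≤-refl

  crossTerm : PS → ℕ → ℕ → Carrier
  crossTerm B m i = if (i <ᵇ (m ∸ i)) ∧ odd (m C i) then B i * B (m ∸ i) else 0#

  crossTerm-≈ : ∀ A B m i → (i < m ∸ i → A i * A (m ∸ i) ≈ B i * B (m ∸ i)) →
                crossTerm A m i ≈ crossTerm B m i
  crossTerm-≈ A B m i h =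
    if-cong ((i <ᵇ (m ∸ i)) ∧ odd (m C i)) (h ∘ <ᵇ⇒< i (m ∸ i) ∘ proj₁ ∘ Equivalence.to T-∧)

  crossTerm-≈0 : ∀ B m i → (i < m ∸ i → T (odd (m C i)) → B i * B (m ∸ i) ≈ 0#) →
                 crossTerm B m i ≈ 0#
  crossTerm-≈0 B m i h = if-≈0 ((i <ᵇ (m ∸ i)) ∧ odd (m C i)) λ t →
    let (t₁ , t₂) = Equivalence.to T-∧ t in h (<ᵇ⇒< i (m ∸ i) t₁) t₂

  crossTerm-0 : ∀ B {M} → OneUnit B → 0 < M → crossTerm B M 0 ≈ B M
  crossTerm-0 B B₀≈1 (s≤s z≤n) = trans (*-congʳ B₀≈1) (*-identityˡ _)

  crossTerm-cong : ∀ A B M i → A ≈[< M ] B → 0 < i → crossTerm A M i ≈ crossTerm B M i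
  crossTerm-cong A B M i A≈B 0<i = crossTerm-≈ A B M i λ i<M∸i →
    let i<M = <-≤-trans i<M∸i (m∸n≤m M i)
    in  *-cong (A≈B i<M) (A≈B (∸-monoʳ-< 0<i (<⇒≤ i<M)))

  even⇒¬odd : ∀ n → parity n ≡ 0ℙ → ¬ T (odd n)
  even⇒¬odd zero          _  ()
  even⇒¬odd (suc zero)    ()
  even⇒¬odd (suc (suc n)) e  = even⇒¬odd n e

  crossTerm-carry : ∀ L B n i → i < 2 ^ L → n ∸ i < 2 ^ L → 2 ^ L ≤ n → crossTerm B n i ≈ 0#
  crossTerm-carry L B n i i< n∸i< 2^L≤n = crossTerm-≈0 B n i λ i<n∸i odd[nCi] →
    let i+[n∸i]≡n = m+[n∸m]≡n (<⇒≤ (<-≤-trans i<n∸i (m∸n≤m n i)))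
        even[nCi] = ≡.subst (λ k → parity (k C i) ≡ 0ℙ) i+[n∸i]≡n
                      (parity[[i+j]Ci]≡0 L i< n∸i< (≡.subst (2 ^ L ≤_) (≡.sym i+[n∸i]≡n) 2^L≤n))
    in  ⊥-elim (even⇒¬odd (n C i) even[nCi] odd[nCi])

  σ-oneUnit : ∀ B → OneUnit B → OneUnit (σ B)
  σ-oneUnit B B₀≈1 = begin
    B 0 * B 0 + (0# + 0#)  ≈⟨ +-cong (*-cong B₀≈1 B₀≈1) (+-identityˡ 0#) ⟩
    1# * 1# + 0#           ≈⟨ +-identityʳ (1# * 1#) ⟩
    1# * 1#                ≈⟨ *-identityˡ 1# ⟩
    1# ∎

  σ-cong-< : ∀ {A B} N → A ≈[< N ] B → σ A ≈[< N ] σ B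
  σ-cong-< {A} {B} N A≈B {m} m<N =
    +-cong (if-cong _ λ _ → *-cong (A≈B m/2<N) (A≈B m/2<N))
           (sumTo-cong (suc m) λ {i} i<1+m → crossTerm-≈ A B m i λ _ →
              *-cong (A≈B (<-≤-trans i<1+m m<N)) (A≈B (≤-<-trans (m∸n≤m m i) m<N)))
    where
    m/2<N = ≤-<-trans (m/n≤m m 2) m<N

  σ-cong : ∀ {A B} → A ≈ₛ B → σ A ≈ₛ σ B
  σ-cong A≈B = ≈[<]⇒≈ₛ λ N → σ-cong-< N (≈ₛ⇒≈[<] A≈B N)

  σ-+-local : ∀ {A B} N → OneUnit A → OneUnit B → A ≈[< N ] B → σ A N + A N ≈ σ B N + B N
  σ-+-local {A} {B} zero oA oB _ = trans (+-cong (σ-oneUnit A oA) oA) (sym (+-cong (σ-oneUnit B oB) oB))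
  σ-+-local {A} {B} (suc n) oA oB A≈B = +-exchange (begin
    (dA + cA) + (dB + cB)           ≈⟨ interchange dA cA dB cB ⟩
    (dA + dB) + (cA + cB)           ≈⟨ +-cong (x≈y⇒x+y≈0 dA≈dB) (sumTo-+ (suc M) (crossTerm A M) (crossTerm B M)) ⟩
    0# + sumTo (suc M) cross        ≈⟨ +-identityˡ _ ⟩
    sumTo (suc M) cross             ≈⟨ sumTo-head M (λ {i} 0<i _ → x≈y⇒x+y≈0 (crossTerm-cong A B M i A≈B 0<i)) ⟩
    crossTerm A M 0 + crossTerm B M 0  ≈⟨ +-cong (crossTerm-0 A oA z<s) (crossTerm-0 B oB z<s) ⟩
    A M + B M ∎)
    where
    M = suc n
    diagonal = (M ≡ᵇ 0) ∨ isPow2Pos M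
    dA = if diagonal then A (M / 2) * A (M / 2) else 0#
    dB = if diagonal then B (M / 2) * B (M / 2) else 0#
    cA = sumTo (suc M) (crossTerm A M)
    cB = sumTo (suc M) (crossTerm B M)
    cross = λ i → crossTerm A M i + crossTerm B M i
    M/2<M = m/n<m M 2 (s≤s (s≤s z≤n))
    dA≈dB = if-cong diagonal λ _ → *-cong (A≈B M/2<M) (A≈B M/2<M)

  σ^-oneUnit : ∀ n A → OneUnit A → OneUnit (σ^ n A)
  σ^-oneUnit zero    A oA = oA
  σ^-oneUnit (suc n) A oA = σ-oneUnit (σ^ n A) (σ^-oneUnit n A oA)

  σ^-+ : ∀ m n A → σ^ (m +ℕ n) A ≡ σ^ m (σ^ n A)
  σ^-+ zero    n A = ≡.refl
  σ^-+ (suc m) n A = ≡.cong σ (σ^-+ m n A)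

  σ^-cong-< : ∀ n {A B} N → A ≈[< N ] B → σ^ n A ≈[< N ] σ^ n B
  σ^-cong-< zero    N A≈B = A≈B
  σ^-cong-< (suc n) N A≈B = σ-cong-< N (σ^-cong-< n N A≈B)

  σ^-cong : ∀ n {A B} → A ≈ₛ B → σ^ n A ≈ₛ σ^ n B
  σ^-cong zero    A≈B = A≈B
  σ^-cong (suc n) A≈B = σ-cong (σ^-cong n A≈B)

  σ^-+-local : ∀ n N {A B} → OneUnit A → OneUnit B → A ≈[< N ] B → σ^ n A N + A N ≈ σ^ n B N + B N
  σ^-+-local zero    N {A} {B} _ _ _ = trans (x+x≈0 (A N)) (sym (x+x≈0 (B N)))
  σ^-+-local (suc n) N {A} {B} oA oB A≈B = begin
    σ (σ^ n A) N + A N                            ≈⟨ +-telescope _ (σ^ n A N) _ ⟨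
    (σ (σ^ n A) N + σ^ n A N) + (σ^ n A N + A N)  ≈⟨ +-cong step (σ^-+-local n N oA oB A≈B) ⟩
    (σ (σ^ n B) N + σ^ n B N) + (σ^ n B N + B N)  ≈⟨ +-telescope _ (σ^ n B N) _ ⟩
    σ (σ^ n B) N + B N ∎
    where
    step = σ-+-local N (σ^-oneUnit n A oA) (σ^-oneUnit n B oB) (σ^-cong-< n N A≈B)

  -- σ^(2^(N+1)) = σ^(2^N) ∘ σ^(2^N), and at index N both halves add the same increment,
  -- which cancels in characteristic 2.
  σ^[2^N]≈[<N] : ∀ N A → OneUnit A → σ^ (2 ^ N) A ≈[< N ] A
  σ^[2^N]≈[<N] zero    A oA ()
  σ^[2^N]≈[<N] (suc N) A oA =
    ≡.subst (λ C → C ≈[< suc N ] A) (≡.sym σ^[2^[1+N]]≡σ^[2^N]²) (≈[<]-extend below at-N)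
    where
    q = 2 ^ N
    B = σ^ q A
    B≈A : B ≈[< N ] A
    B≈A = σ^[2^N]≈[<N] N A oA
    σ^[2^[1+N]]≡σ^[2^N]² : σ^ (2 ^ suc N) A ≡ σ^ q B
    σ^[2^[1+N]]≡σ^[2^N]² = ≡.trans (≡.cong (λ k → σ^ k A) (2^[1+n]≡2^n+2^n N)) (σ^-+ q q A)
    below : σ^ q B ≈[< N ] A
    below = ≈[<]-trans (σ^-cong-< q N B≈A) B≈A
    at-N : σ^ q B N ≈ A N
    at-N = ∙-cancelʳ (B N) _ _
             (trans (σ^-+-local q N (σ^-oneUnit q A oA) oA B≈A) (+-comm (B N) (A N)))

  σ-injective : ∀ {A B} → OneUnit A → OneUnit B → σ A ≈ₛ σ B → A ≈ₛ B
  σ-injective {A} {B} oA oB σA≈σB = ≈[<]⇒≈ₛ below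
    where
    below : ∀ N → A ≈[< N ] B
    below zero    ()
    below (suc N) = ≈[<]-extend (below N)
      (∙-cancelˡ (σ B N) _ _ (trans (+-congʳ (sym (σA≈σB N))) (σ-+-local N oA oB (below N))))

  σ^-injective : ∀ n {A B} → OneUnit A → OneUnit B → σ^ n A ≈ₛ σ^ n B → A ≈ₛ B
  σ^-injective zero    _  _  A≈B = A≈B
  σ^-injective (suc n) {A} {B} oA oB σ^A≈σ^B =
    σ^-injective n oA oB (σ-injective (σ^-oneUnit n A oA) (σ^-oneUnit n B oB) σ^A≈σ^B)

  IsPeriodBelow : ℕ → PS → ℕ → Set ℓ
  IsPeriodBelow N A t = σ^ t A ≈[< N ] A

  IsPeriod : PS → ℕ → Set ℓ
  IsPeriod A t = σ^ t A ≈ₛ A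

  isPeriodBelow-isDifferenceClosed : ∀ N A → IsDifferenceClosed (IsPeriodBelow N A)
  isPeriodBelow-isDifferenceClosed N A = record
    { 0-closed = λ _ → refl
    ; +-closed = λ {a} {b} pa pb →
        ≈[<]-trans (≈[<]-reflexive (σ^-+ a b A)) (≈[<]-trans (σ^-cong-< a N pb) pa)
    ; ∸-closed = λ {a} {b} pab pa →
        ≈[<]-trans (σ^-cong-< b N (≈[<]-sym pa))
          (≈[<]-trans (≈[<]-reflexive (≡.trans (≡.sym (σ^-+ b a A)) (≡.cong (λ k → σ^ k A) (ℕₚ.+-comm b a))))
                      pab)
    }

  isPeriod-isDifferenceClosed : ∀ A → IsDifferenceClosed (IsPeriod A)
  isPeriod-isDifferenceClosed A = record
    { 0-closed = λ _ → refl
    ; +-closed = λ {a} {b} pa pb → ≈[<]⇒≈ₛ λ N → +-closed (below N) {a} {b} (≈ₛ⇒≈[<] pa N) (≈ₛ⇒≈[<] pb N)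
    ; ∸-closed = λ {a} {b} pab pa → ≈[<]⇒≈ₛ λ N → ∸-closed (below N) {a} {b} (≈ₛ⇒≈[<] pab N) (≈ₛ⇒≈[<] pa N)
    }
    where
    open IsDifferenceClosed
    below = λ N → isPeriodBelow-isDifferenceClosed N A

  -- Below each N both p and 2^(v+N) are periods; 2^v is their greatest common divisor.
  period⇒2-power-period : ∀ {A p} → OneUnit A → 0 < p → IsPeriod A p → ∃ λ v → IsPeriod A (2 ^ v)
  period⇒2-power-period {A} {p} oA 0<p per with 2-adic p 0<p
  ... | v , s , p≡ = v , ≈[<]⇒≈ₛ λ N →
    let open IsDifferenceClosed (isPeriodBelow-isDifferenceClosed N A)
    in  2-adic-part-closed v s N
          (≡.subst (IsPeriodBelow N A) p≡ (≈ₛ⇒≈[<] per N))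
          (≡.subst (IsPeriodBelow N A) (≡.sym (^-distribˡ-+-* 2 v N)) (*-closed (2 ^ v) (σ^[2^N]≈[<N] N A oA)))

  σ^-inOrbit : ∀ {A} → OneUnit A → ∀ n → InOrbit A (σ^ n A)
  σ^-inOrbit {A} oA n = σ^-oneUnit n A oA , n , inj₁ λ _ → refl

  σ^-%-period : ∀ {A P} .{{_ : NonZero P}} → IsPeriod A P → ∀ k → σ^ (k % P) A ≈ₛ σ^ k A
  σ^-%-period {A} {P} per k = ≈ₛ.sym (≈ₛ.trans
    (≈ₛ.reflexive (≡.trans (≡.cong (λ t → σ^ t A) (m≡m%n+[m/n]*n k P)) (σ^-+ (k % P) _ A)))
    (σ^-cong (k % P) (*-closed (k / P) per)))
    where open IsDifferenceClosed (isPeriod-isDifferenceClosed A)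

  σ^≈σ^⇒period : ∀ {A a b} → OneUnit A → a ≤ b → σ^ a A ≈ₛ σ^ b A → IsPeriod A (b ∸ a)
  σ^≈σ^⇒period {A} {a} {b} oA a≤b σ^aA≈σ^bA = ≈ₛ.sym (σ^-injective a oA (σ^-oneUnit (b ∸ a) A oA)
    (≈ₛ.trans σ^aA≈σ^bA
      (≈ₛ.reflexive (≡.trans (≡.cong (λ k → σ^ k A) (≡.sym (m+[n∸m]≡n a≤b))) (σ^-+ a (b ∸ a) A)))))

  -- A backward iterate σ^(-k) A of a periodic A is the forward iterate σ^((P-1)k) A.
  periodic⇒inOrbit-forward : ∀ {A B P} → OneUnit A → 0 < P → IsPeriod A P → InOrbit A B →
                             ∃ λ k → σ^ k A ≈ₛ B
  periodic⇒inOrbit-forward _ _ _ (_ , k , inj₁ σ^kA≈B) = k , σ^kA≈B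
  periodic⇒inOrbit-forward {A} {B} {suc P} oA _ per (oB , k , inj₂ σ^kB≈A) =
    P *ℕ k , σ^-injective k (σ^-oneUnit (P *ℕ k) A oA) oB
      (≈ₛ.trans (≈ₛ.reflexive (≡.sym (σ^-+ k (P *ℕ k) A)))
        (≈ₛ.trans (≡.subst (IsPeriod A) (ℕₚ.*-comm k (suc P)) (*-closed k per)) (≈ₛ.sym σ^kB≈A)))
    where open IsDifferenceClosed (isPeriod-isDifferenceClosed A)

  least-2-power-period⇒no-smaller-period : ∀ {A w t} → IsPeriod A (2 ^ w) →
    (∀ {u} → u < w → ¬ IsPeriod A (2 ^ u)) → 0 < t → t < 2 ^ w → ¬ IsPeriod A t
  least-2-power-period⇒no-smaller-period {A} {w} {t} per least 0<t t<2^w per-t with 2-adic t 0<t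
  ... | u , s , t≡ with u <? w
  ...   | yes u<w = least u<w (2-adic-part-closed u s (w ∸ u) (≡.subst (IsPeriod A) t≡ per-t)
                      (≡.subst (λ k → IsPeriod A (2 ^ k)) (≡.sym (m+[n∸m]≡n (<⇒≤ u<w))) per))
    where open IsDifferenceClosed (isPeriod-isDifferenceClosed A)
  ...   | no u≮w  = <⇒≱ t<2^w (ℕₚ.≤-trans (^-monoʳ-≤ 2 (≮⇒≥ u≮w))
                      (≡.subst (2 ^ u ≤_) (≡.sym t≡) (m≤m*n (2 ^ u) (suc (double s)))))

  least-2-power-period⇒orbitCard : ∀ {A w} → OneUnit A → IsPeriod A (2 ^ w) →
    (∀ {u} → u < w → ¬ IsPeriod A (2 ^ u)) → OrbitCard A (2 ^ w)
  least-2-power-period⇒orbitCard {A} {w} oA per least = enum , σ^-inOrbit oA ∘ toℕ , covers , injective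
    where
    instance _ = m^n≢0 2 w
    enum : Fin (2 ^ w) → PS
    enum i = σ^ (toℕ i) A
    covers : ∀ B → InOrbit A B → Σ (Fin (2 ^ w)) λ i → enum i ≈ₛ B
    covers B B∈orbit with periodic⇒inOrbit-forward oA (m^n>0 2 w) per B∈orbit
    ... | k , σ^kA≈B = fromℕ< (m%n<n k (2 ^ w)) , ≈ₛ.trans
      (≈ₛ.reflexive (≡.cong (λ t → σ^ t A) (Fin.toℕ-fromℕ< (m%n<n k (2 ^ w)))))
      (≈ₛ.trans (σ^-%-period per k) σ^kA≈B)
    no-repeat : ∀ {i j} → toℕ i < toℕ j → ¬ enum i ≈ₛ enum j
    no-repeat {i} {j} i<j e = least-2-power-period⇒no-smaller-period per least (m<n⇒0<n∸m i<j)
      (≤-<-trans (m∸n≤m (toℕ j) (toℕ i)) (Fin.toℕ<n j)) (σ^≈σ^⇒period oA (<⇒≤ i<j) e)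
    injective : ∀ i j → enum i ≈ₛ enum j → i ≡ j
    injective i j e with <-cmp (toℕ i) (toℕ j)
    ... | tri< i<j _ _ = contradiction e (no-repeat i<j)
    ... | tri≈ _ i≡j _ = Fin.toℕ-injective i≡j
    ... | tri> _ _ j<i = contradiction (≈ₛ.sym e) (no-repeat j<i)

  orbitCard-≤ : ∀ {A m n} → OrbitCard A m → OrbitCard A n → m ≤ n
  orbitCard-≤ {m = m} {n} (f , f∈orbit , _ , f-injective) (g , _ , g-covers , _) = Fin.injective⇒≤ h-injective
    where
    h : Fin m → Fin n
    h i = proj₁ (g-covers (f i) (f∈orbit i))
    h-injective : ∀ {i j} → h i ≡ h j → i ≡ j
    h-injective {i} {j} hi≡hj = f-injective i j (≈ₛ.trans (≈ₛ.sym (proj₂ (g-covers (f i) (f∈orbit i))))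
      (≈ₛ.trans (≈ₛ.reflexive (≡.cong g hi≡hj)) (proj₂ (g-covers (f j) (f∈orbit j)))))

  orbitCard-unique : ∀ {A m n} → OrbitCard A m → OrbitCard A n → m ≡ n
  orbitCard-unique card card′ = ℕₚ.≤-antisym (orbitCard-≤ card card′) (orbitCard-≤ card′ card)

  orbitCard-locate : ∀ {A m} → OneUnit A → (card : OrbitCard A m) → ∀ t →
                     Σ (Fin m) λ i → proj₁ card i ≈ₛ σ^ t A
  orbitCard-locate oA (_ , _ , covers , _) t = covers _ (σ^-inOrbit oA t)

  orbitCard-same-place : ∀ {A m} (oA : OneUnit A) (card : OrbitCard A m) {a b} →
    proj₁ (orbitCard-locate oA card a) ≡ proj₁ (orbitCard-locate oA card b) → σ^ a A ≈ₛ σ^ b A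
  orbitCard-same-place oA card {a} {b} same = ≈ₛ.trans (≈ₛ.sym (proj₂ (orbitCard-locate oA card a)))
    (≈ₛ.trans (≈ₛ.reflexive (≡.cong (proj₁ card) same)) (proj₂ (orbitCard-locate oA card b)))

  orbitCard⇒isPeriod? : ∀ {A m} → OneUnit A → OrbitCard A m → Decidable (IsPeriod A)
  orbitCard⇒isPeriod? {A} oA card t
    with proj₁ (orbitCard-locate oA card t) Fin.≟ proj₁ (orbitCard-locate oA card 0)
  ... | yes same = yes (orbitCard-same-place oA card same)
  ... | no apart = no λ per → apart (proj₂ (proj₂ (proj₂ card)) _ _ (≈ₛ.trans
          (proj₂ (orbitCard-locate oA card t)) (≈ₛ.trans per (≈ₛ.sym (proj₂ (orbitCard-locate oA card 0))))))

  orbitCard⇒period : ∀ {A m} → OneUnit A → OrbitCard A m → ∃ λ p → 0 < p × IsPeriod A p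
  orbitCard⇒period {A} {m} oA card
    with Fin.pigeonhole (n<1+n m) (λ i → proj₁ (orbitCard-locate oA card (toℕ i)))
  ... | i , j , i<j , same =
    toℕ j ∸ toℕ i , m<n⇒0<n∸m i<j , σ^≈σ^⇒period oA (<⇒≤ i<j) (orbitCard-same-place oA card same)

  2-power-period⇒orbitCard : ∀ {A} v → OneUnit A → Decidable (IsPeriod A) → IsPeriod A (2 ^ v) →
                             ∃ λ w → OrbitCard A (2 ^ w)
  2-power-period⇒orbitCard v oA isPeriod? per with least-witness (λ u → isPeriod? (2 ^ u)) {v} per
  ... | w , per-2^w , least = w , least-2-power-period⇒orbitCard {w = w} oA per-2^w least

  isPow2Pos-2^[1+j] : ∀ j → T (isPow2Pos (2 ^ suc j))
  isPow2Pos-2^[1+j] j =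
    any⁺ _ (lose (∈-upTo⁺ (ℕₚ.<-trans (n<1+n j) (n<2^n (suc j)))) (≡⇒≡ᵇ (2 ^ suc j) _ ≡.refl))

  isPow2Pos⇒2^[1+j] : ∀ n → T (isPow2Pos n) → ∃ λ j → 2 ^ suc j ≡ n
  isPow2Pos⇒2^[1+j] n pow with satisfied (any⁻ _ (upTo n) pow)
  ... | j , 2^[1+j]≡ᵇn = j , ≡ᵇ⇒≡ _ _ 2^[1+j]≡ᵇn

  σ-coeff-1 : ∀ B → OneUnit B → σ B 1 ≈ B 1
  σ-coeff-1 B B₀≈1 = begin
    0# + ((0# + B 0 * B 1) + 0#)  ≈⟨ +-identityˡ _ ⟩
    (0# + B 0 * B 1) + 0#         ≈⟨ +-identityʳ _ ⟩
    0# + B 0 * B 1                ≈⟨ +-identityˡ _ ⟩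
    B 0 * B 1                     ≈⟨ *-congʳ B₀≈1 ⟩
    1# * B 1                      ≈⟨ *-identityˡ (B 1) ⟩
    B 1 ∎

  σ-coeff-2^[1+j] : ∀ B → OneUnit B → ∀ j → σ B (2 ^ suc j) ≈ B (2 ^ suc j) + B (2 ^ j) * B (2 ^ j)
  σ-coeff-2^[1+j] B B₀≈1 j = trans (+-cong diagonal cross) (+-comm _ _)
    where
    m = 2 ^ suc j
    diagonal : (if (m ≡ᵇ 0) ∨ isPow2Pos m then B (m / 2) * B (m / 2) else 0#) ≈ B (2 ^ j) * B (2 ^ j)
    diagonal = trans (if-true _ (Equivalence.from T-∨ (inj₂ (isPow2Pos-2^[1+j] j))))
                     (reflexive (≡.cong (λ k → B k * B k) (2^[1+n]/2≡2^n j)))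
    vanish : ∀ {i} → 0 < i → i < suc m → crossTerm B m i ≈ 0#
    vanish {i} 0<i i<1+m with m<1+n⇒m<n∨m≡n i<1+m
    ... | inj₁ i<m    = crossTerm-carry (suc j) B m i i<m (∸-monoʳ-< 0<i (<⇒≤ i<m)) ≤-refl
    ... | inj₂ ≡.refl = crossTerm-≈0 B m m λ m<m∸m _ → ⊥-elim (n≮0 (≡.subst (m <_) (n∸n≡0 m) m<m∸m))
    cross : sumTo (suc m) (crossTerm B m) ≈ B m
    cross = trans (sumTo-head m vanish) (crossTerm-0 B B₀≈1 (m^n>0 2 (suc j)))

  Pow2CoeffLaw : ℕ → Set (c ⊔ ℓ)
  Pow2CoeffLaw k = ∀ A → OneUnit A → ∀ j → σ^ k A (2 ^ (j +ℕ k)) ≈ A (2 ^ (j +ℕ k)) + frob k (A (2 ^ j))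

  pow2CoeffLaw-1 : Pow2CoeffLaw 1
  pow2CoeffLaw-1 A oA j rewrite ℕₚ.+-comm j 1 = σ-coeff-2^[1+j] A oA j

  -- Squaring the additive operator a ↦ a + F(shift a) in characteristic 2 gives a ↦ a + F²(shift² a).
  pow2CoeffLaw-+ : ∀ {k} → Pow2CoeffLaw k → Pow2CoeffLaw (k +ℕ k)
  pow2CoeffLaw-+ {k} law A oA j = begin
    σ^ (k +ℕ k) A X                                         ≡⟨ ≡.cong (λ F → F X) (σ^-+ k k A) ⟩
    σ^ k B X                                                ≡⟨ ≡.cong (σ^ k B) X≡X′ ⟩
    σ^ k B X′                                               ≈⟨ law B (σ^-oneUnit k A oA) (j +ℕ k) ⟩
    B X′ + frob k (B Y)                                     ≈⟨ +-cong (law A oA (j +ℕ k)) (frob-cong k (law A oA j)) ⟩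
    (A X′ + frob k (A Y)) + frob k (A Y + frob k (A Z))     ≈⟨ +-congˡ (frob-+ k _ _) ⟩
    (A X′ + frob k (A Y)) + (frob k (A Y) + frob k (frob k (A Z)))  ≈⟨ +-telescope _ _ _ ⟩
    A X′ + frob k (frob k (A Z))                            ≡⟨ ≡.cong₂ _+_ (≡.cong A (≡.sym X≡X′)) (≡.sym (frob-+ℕ k k _)) ⟩
    A X + frob (k +ℕ k) (A Z) ∎
    where
    B = σ^ k A
    X = 2 ^ (j +ℕ (k +ℕ k))
    X′ = 2 ^ ((j +ℕ k) +ℕ k)
    Y = 2 ^ (j +ℕ k)
    Z = 2 ^ j
    X≡X′ : X ≡ X′
    X≡X′ = ≡.cong (2 ^_) (≡.sym (ℕₚ.+-assoc j k k))

  pow2CoeffLaw-2^ : ∀ v → Pow2CoeffLaw (2 ^ v)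
  pow2CoeffLaw-2^ zero    = pow2CoeffLaw-1
  pow2CoeffLaw-2^ (suc v) = ≡.subst Pow2CoeffLaw (≡.sym (2^[1+n]≡2^n+2^n v)) (pow2CoeffLaw-+ {2 ^ v} (pow2CoeffLaw-2^ v))

  2-power-period⇒pow2-coeff≈0 : ∀ {A} v → OneUnit A → IsPeriod A (2 ^ v) → ∀ k → A (2 ^ k) ≈ 0#
  2-power-period⇒pow2-coeff≈0 {A} v oA per k = frob≈0⇒≈0 (2 ^ v) (∙-cancelˡ (A X) _ _ (begin
    A X + frob (2 ^ v) (A (2 ^ k))  ≈⟨ pow2CoeffLaw-2^ v A oA k ⟨
    σ^ (2 ^ v) A X                  ≈⟨ per X ⟩
    A X                             ≈⟨ +-identityʳ (A X) ⟨
    A X + 0# ∎))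
    where
    X = 2 ^ (k +ℕ 2 ^ v)

  finiteOrbit⇒pow2-coeff≈0 : ∀ {A} → OneUnit A → FiniteOrbit A → ∀ k → A (2 ^ k) ≈ 0#
  finiteOrbit⇒pow2-coeff≈0 oA (_ , card) with orbitCard⇒period oA card
  ... | p , 0<p , per with period⇒2-power-period oA 0<p per
  ...   | v , per-2^v = 2-power-period⇒pow2-coeff≈0 v oA per-2^v

  orbitCard⇒2-power : ∀ {A m} → OneUnit A → OrbitCard A m → ∃ λ j → m ≡ 2 ^ j
  orbitCard⇒2-power oA card with orbitCard⇒period oA card
  ... | p , 0<p , per with period⇒2-power-period oA 0<p per
  ...   | v , per-2^v with 2-power-period⇒orbitCard v oA (orbitCard⇒isPeriod? oA card) per-2^v
  ...     | w , card-2^w = w , orbitCard-unique card card-2^w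

  record Pow2FreePoly (N : ℕ) (B : PS) : Set ℓ where
    constructor pow2FreePoly
    field
      oneUnit      : OneUnit B
      coeff≈0-from : ∀ {n} → 2 ^ N ≤ n → B n ≈ 0#
      pow2-coeff≈0 : ∀ k → B (2 ^ k) ≈ 0#

  open Pow2FreePoly

  σ-pow2-coeff≈0 : ∀ B → OneUnit B → (∀ k → B (2 ^ k) ≈ 0#) → ∀ k → σ B (2 ^ k) ≈ 0#
  σ-pow2-coeff≈0 B oB B[2^]≈0 zero    = trans (σ-coeff-1 B oB) (B[2^]≈0 0)
  σ-pow2-coeff≈0 B oB B[2^]≈0 (suc j) = begin
    σ B (2 ^ suc j)                        ≈⟨ σ-coeff-2^[1+j] B oB j ⟩
    B (2 ^ suc j) + B (2 ^ j) * B (2 ^ j)  ≈⟨ +-cong (B[2^]≈0 (suc j)) (*-congʳ (B[2^]≈0 j)) ⟩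
    0# + 0# * B (2 ^ j)                    ≈⟨ +-identityˡ _ ⟩
    0# * B (2 ^ j)                         ≈⟨ zeroˡ (B (2 ^ j)) ⟩
    0# ∎

  σ-coeff≈0-above : ∀ N {B} → (∀ k → B (2 ^ k) ≈ 0#) → (∀ {n} → 2 ^ N ≤ n → B n ≈ 0#) →
                    ∀ {n} → 2 ^ N ≤ n → σ B n ≈ 0#
  σ-coeff≈0-above N {B} B[2^]≈0 B≈0 {n} 2^N≤n =
    trans (+-cong (if-≈0 _ λ t → trans (*-congʳ (half≈0 t)) (zeroˡ _)) (sumTo-≈0 (suc n) λ {i} _ → cross≈0 i))
          (+-identityˡ 0#)
    where
    half≈0 : T ((n ≡ᵇ 0) ∨ isPow2Pos n) → B (n / 2) ≈ 0#
    half≈0 t with Equivalence.to T-∨ t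
    ... | inj₁ n≡ᵇ0 = contradiction (≡.subst (2 ^ N ≤_) (≡ᵇ⇒≡ n 0 n≡ᵇ0) 2^N≤n) (<⇒≱ (m^n>0 2 N))
    ... | inj₂ pow with isPow2Pos⇒2^[1+j] n pow
    ...   | j , 2^[1+j]≡n =
      trans (reflexive (≡.cong (λ k → B (k / 2)) (≡.sym 2^[1+j]≡n)))
            (trans (reflexive (≡.cong B (2^[1+n]/2≡2^n j))) (B[2^]≈0 j))
    cross≈0 : ∀ i → crossTerm B n i ≈ 0#
    cross≈0 i with 2 ^ N ≤? i | 2 ^ N ≤? n ∸ i
    ... | yes 2^N≤i | _ = crossTerm-≈0 B n i λ _ _ → trans (*-congʳ (B≈0 2^N≤i)) (zeroˡ _)
    ... | no _ | yes 2^N≤n∸i = crossTerm-≈0 B n i λ _ _ → trans (*-congˡ (B≈0 2^N≤n∸i)) (zeroʳ _)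
    ... | no i≱ | no n∸i≱ = crossTerm-carry N B n i (≰⇒> i≱) (≰⇒> n∸i≱) 2^N≤n

  σ-pow2FreePoly : ∀ {N B} → Pow2FreePoly N B → Pow2FreePoly N (σ B)
  σ-pow2FreePoly {N} {B} (pow2FreePoly oB B≈0 B[2^]≈0) =
    pow2FreePoly (σ-oneUnit B oB) (σ-coeff≈0-above N B[2^]≈0 B≈0) (σ-pow2-coeff≈0 B oB B[2^]≈0)

  σ^-pow2FreePoly : ∀ t {N B} → Pow2FreePoly N B → Pow2FreePoly N (σ^ t B)
  σ^-pow2FreePoly zero    polyB = polyB
  σ^-pow2FreePoly (suc t) polyB = σ-pow2FreePoly (σ^-pow2FreePoly t polyB)

  pow2FreePoly-≈[<]⇒period : ∀ {N A} → Pow2FreePoly N A → ∀ t → σ^ t A ≈[< 2 ^ N ] A → IsPeriod A t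
  pow2FreePoly-≈[<]⇒period {N} {A} polyA t below m with 2 ^ N ≤? m
  ... | yes 2^N≤m = trans (coeff≈0-from (σ^-pow2FreePoly t polyA) 2^N≤m) (sym (coeff≈0-from polyA 2^N≤m))
  ... | no  m≱    = below (≰⇒> m≱)

  pow2FreePoly-isPeriod? : ∀ {N A} → Pow2FreePoly N A → Decidable (IsPeriod A)
  pow2FreePoly-isPeriod? {N} {A} polyA t with allUpTo? (λ m → σ^ t A m ≟ A m) (2 ^ N)
  ... | yes below   = yes (pow2FreePoly-≈[<]⇒period polyA t below)
  ... | no ¬below   = no λ per → ¬below λ {m} _ → per m

  pow2FreePoly⇒finiteOrbit : ∀ {N A} → Pow2FreePoly N A → FiniteOrbit A
  pow2FreePoly⇒finiteOrbit {N} {A} polyA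
    with 2-power-period⇒orbitCard (2 ^ N) (oneUnit polyA) (pow2FreePoly-isPeriod? polyA)
           (pow2FreePoly-≈[<]⇒period polyA (2 ^ 2 ^ N) (σ^[2^N]≈[<N] (2 ^ N) A (oneUnit polyA)))
  ... | w , card = 2 ^ w , card

  polynomial⇒pow2FreePoly : ∀ {A} → OneUnit A → Polynomial A → (∀ k → A (2 ^ k) ≈ 0#) →
                            ∃ λ N → Pow2FreePoly N A
  polynomial⇒pow2FreePoly oA (N , A≈0) A[2^]≈0 =
    N , pow2FreePoly oA (λ 2^N≤n → A≈0 _ (ℕₚ.≤-trans (<⇒≤ (n<2^n N)) 2^N≤n)) A[2^]≈0

proposition4p7 : ∀ {c ℓ : Level} (K : AlgClosureF2 c ℓ) →
  let open AlgClosureF2 K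
      open PowerSeries K
  in ((A : PS) → OneUnit A → (k : ℕ) → ¬ (A (2 ^ k) ≈ 0#) → ¬ FiniteOrbit A)
     × ((A : PS) → OneUnit A → Polynomial A → ((k : ℕ) → A (2 ^ k) ≈ 0#) → FiniteOrbit A)
     × ((A : PS) → OneUnit A → (m : ℕ) → OrbitCard A m → Σ ℕ λ j → m ≡ 2 ^ j)
proposition4p7 K =
    (λ A oA k A[2^k]≉0 finite → A[2^k]≉0 (finiteOrbit⇒pow2-coeff≈0 K oA finite k))
  , (λ A oA poly A[2^]≈0 → pow2FreePoly⇒finiteOrbit K (proj₂ (polynomial⇒pow2FreePoly K oA poly A[2^]≈0)))
  , (λ A oA m card → orbitCard⇒2-power K oA card)
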